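{- Let $\mathbf{C}$ be a locally small category, $\Omega$ an object, $\Phi\colon \mathbf{C}^{\mathrm{op}}\to\mathbf{Pos}$ a functor whose fibres $(\Phi X,\preceq)$ have arbitrary meets preserved by all reindexing maps $f^*:=\Phi f$, and $d_\Omega\in\Phi\Omega$. Let $\alpha_X(S)=\bigwedge_{k\in S}k^*(d_\Omega)$ and $\gamma_X(d)=\{k\in\mathbf{C}(X,\Omega)\mid d\preceq k^*(d_\Omega)\}$. Then $\gamma$ is laxly natural: for every $f\colon X\to Y$ and $d\in\Phi Y$, $\mathcal{P}(f^\bullet)(\gamma_Y(d))\subseteq\gamma_X(f^*(d))$. If moreover $\gamma$ is natural (this inclusion is an equality for all $f$ and $d$) and $\mathbf{C}$ has small products, then for every $S\subseteq\mathbf{C}(X,\Omega)$, $$\gamma_X(\alpha_X(S))=\mathcal{P}(\langle S\rangle^\bullet)\big(\gamma_{\Omega^S}(d_{\Omega^S})\big),\qquad\text{where } d_{\Omega^S}=\bigwedge_{k\in S}\pi_k^*(d_\Omega).$$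
   Context: For $f\colon X\to Y$, $f^\bullet\colon\mathbf{C}(Y,\Omega)\to\mathbf{C}(X,\Omega)$, $g\mapsto g\circ f$, and $\mathcal{P}(f^\bullet)$ is its direct image on subsets. $\Omega^S$ is the product of $S$-many copies of $\Omega$ with projections $\pi_k\colon\Omega^S\to\Omega$ ($k\in S$), and $\langle S\rangle\colon X\to\Omega^S$ is the unique morphism with $\pi_k\circ\langle S\rangle=k$ for all $k\in S$. -}

module Defs where

open import Level using (Level; suc; _⊔_)
open import Relation.Binary.PropositionalEquality using (_≡_)
open import Relation.Binary.Bundles using (Poset)
open import Data.Product using (Σ; ∃; _×_; proj₁)
open import Relation.Unary using (Pred; _⊆_; _≐_)

-- A locally small category: hom-sets live in Set ℓ ("small" = level ℓ),
-- equality of morphisms is propositional equality.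
record Category (o ℓ : Level) : Set (suc (o ⊔ ℓ)) where
  infixr 9 _∘_
  field
    Obj : Set o
    Hom : Obj → Obj → Set ℓ
    id  : ∀ {A} → Hom A A
    _∘_ : ∀ {A B C} → Hom B C → Hom A B → Hom A C
    identityˡ : ∀ {A B} {f : Hom A B} → id ∘ f ≡ f
    identityʳ : ∀ {A B} {f : Hom A B} → f ∘ id ≡ f
    assoc : ∀ {A B C D} {f : Hom A B} {g : Hom B C} {h : Hom C D} →
            (h ∘ g) ∘ f ≡ h ∘ (g ∘ f)

record HasSmallProducts {o ℓ : Level} (C : Category o ℓ) : Set (o ⊔ suc ℓ) where
  open Category C
  field
    Π   : {I : Set ℓ} → (I → Obj) → Obj
    π   : {I : Set ℓ} (A : I → Obj) (i : I) → Hom (Π A) (A i)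
    ⟨_⟩ : {I : Set ℓ} {A : I → Obj} {X : Obj} → ((i : I) → Hom X (A i)) → Hom X (Π A)
    π∘⟨⟩ : {I : Set ℓ} {A : I → Obj} {X : Obj} (f : (i : I) → Hom X (A i)) (i : I) →
           π A i ∘ ⟨ f ⟩ ≡ f i
    ⟨⟩-unique : {I : Set ℓ} {A : I → Obj} {X : Obj} (f : (i : I) → Hom X (A i))
                (g : Hom X (Π A)) → ((i : I) → π A i ∘ g ≡ f i) → g ≡ ⟨ f ⟩

record Meets (ι : Level) {c₁ c₂ c₃ : Level} (P : Poset c₁ c₂ c₃) : Set (suc ι ⊔ c₁ ⊔ c₃) where
  open Poset P
  field
    ⋀ : {I : Set ι} → (I → Carrier) → Carrier
    ⋀-lower : {I : Set ι} (F : I → Carrier) (i : I) → ⋀ F ≤ F i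
    ⋀-greatest : {I : Set ι} (F : I → Carrier) (x : Carrier) →
                 ((i : I) → x ≤ F i) → x ≤ ⋀ F

record PosFunctor {o ℓ : Level} (C : Category o ℓ) (c₁ c₂ c₃ : Level)
       : Set (o ⊔ suc ℓ ⊔ suc c₁ ⊔ suc c₂ ⊔ suc c₃) where
  open Category C
  field
    Φ : Obj → Poset c₁ c₂ c₃
  ∣_∣ : Obj → Set c₁
  ∣ X ∣ = Poset.Carrier (Φ X)
  field
    _* : ∀ {X Y} → Hom X Y → ∣ Y ∣ → ∣ X ∣
    *-cong : ∀ {X Y} (f : Hom X Y) {x y : ∣ Y ∣} →
             Poset._≈_ (Φ Y) x y → Poset._≈_ (Φ X) ((f *) x) ((f *) y)
    *-mono : ∀ {X Y} (f : Hom X Y) {x y : ∣ Y ∣} →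
             Poset._≤_ (Φ Y) x y → Poset._≤_ (Φ X) ((f *) x) ((f *) y)
    *-id : ∀ {X} (x : ∣ X ∣) → Poset._≈_ (Φ X) ((id *) x) x
    *-∘ : ∀ {X Y Z} (f : Hom X Y) (g : Hom Y Z) (x : ∣ Z ∣) →
          Poset._≈_ (Φ X) (((g ∘ f) *) x) ((f *) ((g *) x))
    meets : (X : Obj) → Meets ℓ (Φ X)
    *-⋀ : ∀ {X Y} (f : Hom X Y) {I : Set ℓ} (F : I → ∣ Y ∣) →
          Poset._≈_ (Φ X) ((f *) (Meets.⋀ (meets Y) F))
                          (Meets.⋀ (meets X) (λ i → (f *) (F i)))

module Construction {o ℓ c₁ c₂ c₃ : Level} (C : Category o ℓ)
         (F : PosFunctor C c₁ c₂ c₃) (Ω : Category.Obj C)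
         (dΩ : PosFunctor.∣_∣ F Ω) where
  open Category C
  open PosFunctor F

  ⋀[_] : (X : Obj) {I : Set ℓ} → (I → ∣ X ∣) → ∣ X ∣
  ⋀[ X ] = Meets.⋀ (meets X)

  α : (X : Obj) → Pred (Hom X Ω) ℓ → ∣ X ∣
  α X S = ⋀[ X ] (λ (k : Σ (Hom X Ω) S) → (proj₁ k *) dΩ)

  γ : (X : Obj) → ∣ X ∣ → Pred (Hom X Ω) c₃
  γ X d k = Poset._≤_ (Φ X) d ((k *) dΩ)

  _• : ∀ {X Y} → Hom X Y → Hom Y Ω → Hom X Ω
  (f •) g = g ∘ f

  𝒫 : ∀ {X Y} {r : Level} → (Hom Y Ω → Hom X Ω) → Pred (Hom Y Ω) r → Pred (Hom X Ω) (ℓ ⊔ r)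
  𝒫 G A h = ∃ λ g → A g × G g ≡ h

  LaxNatural : Set (o ⊔ ℓ ⊔ c₁ ⊔ c₃)
  LaxNatural = ∀ {X Y} (f : Hom X Y) (d : ∣ Y ∣) → 𝒫 (f •) (γ Y d) ⊆ γ X ((f *) d)

  Natural : Set (o ⊔ ℓ ⊔ c₁ ⊔ c₃)
  Natural = ∀ {X Y} (f : Hom X Y) (d : ∣ Y ∣) → 𝒫 (f •) (γ Y d) ≐ γ X ((f *) d)

  module Powers (P : HasSmallProducts C) where
    open HasSmallProducts P

    Ω^ : {X : Obj} → Pred (Hom X Ω) ℓ → Obj
    Ω^ {X} S = Π (λ (_ : Σ (Hom X Ω) S) → Ω)

    π[_] : {X : Obj} (S : Pred (Hom X Ω) ℓ) (k : Σ (Hom X Ω) S) → Hom (Ω^ S) Ω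
    π[ S ] k = π (λ _ → Ω) k

    ⟨S⟩ : {X : Obj} (S : Pred (Hom X Ω) ℓ) → Hom X (Ω^ S)
    ⟨S⟩ S = ⟨ (λ (k : Σ _ S) → proj₁ k) ⟩

    d^ : {X : Obj} (S : Pred (Hom X Ω) ℓ) → ∣ Ω^ S ∣
    d^ S = ⋀[ Ω^ S ] (λ k → (π[ S ] k *) dΩ)

-- Lax naturality is monotonicity of f* together with f*(g*(d_Ω)) ≈ (g ∘ f)*(d_Ω). Since reindexing
-- preserves meets and π_k ∘ ⟨S⟩ = k, we get ⟨S⟩*(d_{Ω^S}) ≈ α_X(S); naturality at ⟨S⟩ and d_{Ω^S}
-- then gives the equality.
module Submission where

open import Defs
open import Data.Product using (_×_; _,_; proj₁)
open import Level using (Level)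
open import Relation.Unary using (Pred; _⊆_; _≐_)
open import Relation.Unary.Properties using (≐-trans; ≐-sym)
open import Relation.Binary.PropositionalEquality using (refl; cong)
open import Relation.Binary.Bundles using (Poset)
import Relation.Binary.Reasoning.PartialOrder as ≤-Reasoning

module MeetProperties {ι c₁ c₂ c₃ : Level} {P : Poset c₁ c₂ c₃} (M : Meets ι P) where
  open Poset P
  open Meets M

  ⋀-mono : {I : Set ι} {A B : I → Carrier} → (∀ i → A i ≤ B i) → ⋀ A ≤ ⋀ B
  ⋀-mono {B = B} A≤B = ⋀-greatest B _ (λ i → trans (⋀-lower _ i) (A≤B i))

  ⋀-cong : {I : Set ι} {A B : I → Carrier} → (∀ i → A i ≈ B i) → ⋀ A ≈ ⋀ B
  ⋀-cong A≈B = antisym (⋀-mono (λ i → reflexive (A≈B i)))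
                       (⋀-mono (λ i → reflexive (Eq.sym (A≈B i))))

module _ {o ℓ c₁ c₂ c₃} (C : Category o ℓ) (F : PosFunctor C c₁ c₂ c₃)
         (Ω : Category.Obj C) (dΩ : PosFunctor.∣_∣ F Ω) where
  open Category C
  open PosFunctor F
  open Construction C F Ω dΩ
  private module Fib (X : Obj) = Poset (Φ X)

  γ-antitone : (X : Obj) {a b : ∣ X ∣} → Fib._≤_ X a b → γ X b ⊆ γ X a
  γ-antitone X a≤b b≤k*dΩ = Fib.trans X a≤b b≤k*dΩ

  γ-resp-≈ : (X : Obj) {a b : ∣ X ∣} → Fib._≈_ X a b → γ X a ≐ γ X b
  γ-resp-≈ X a≈b = γ-antitone X (Fib.reflexive X (Fib.Eq.sym X a≈b)) , γ-antitone X (Fib.reflexive X a≈b)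

  γ-laxNatural : LaxNatural
  γ-laxNatural {X} f d (g , d≤g*dΩ , refl) = begin
    (f *) d             ≤⟨ *-mono f d≤g*dΩ ⟩
    (f *) ((g *) dΩ)    ≈⟨ Fib.Eq.sym X (*-∘ f g dΩ) ⟩
    ((g ∘ f) *) dΩ      ∎
    where open ≤-Reasoning (Φ X)

  module _ (P : HasSmallProducts C) where
    open HasSmallProducts P
    open Powers P

    ⟨S⟩*-d^≈α : (X : Obj) (S : Pred (Hom X Ω) ℓ) → Fib._≈_ X ((⟨S⟩ S *) (d^ S)) (α X S)
    ⟨S⟩*-d^≈α X S = Fib.Eq.trans X (*-⋀ (⟨S⟩ S) _) (MeetProperties.⋀-cong (meets X) π*dΩ≈k*dΩ)
      where
        π*dΩ≈k*dΩ : ∀ k → Fib._≈_ X ((⟨S⟩ S *) ((π[ S ] k *) dΩ)) ((proj₁ k *) dΩ)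
        π*dΩ≈k*dΩ k = Fib.Eq.trans X (Fib.Eq.sym X (*-∘ (⟨S⟩ S) (π[ S ] k) dΩ))
                        (Fib.Eq.reflexive X (cong (λ h → (h *) dΩ) (π∘⟨⟩ proj₁ k)))

    γ-α≐image-γ-d^ : Natural → (X : Obj) (S : Pred (Hom X Ω) ℓ) →
                     γ X (α X S) ≐ 𝒫 (⟨S⟩ S •) (γ (Ω^ S) (d^ S))
    γ-α≐image-γ-d^ natural X S =
      ≐-trans (γ-resp-≈ X (Fib.Eq.sym X (⟨S⟩*-d^≈α X S))) (≐-sym (natural (⟨S⟩ S) (d^ S)))

lemma1 : ∀ {o ℓ c₁ c₂ c₃} (C : Category o ℓ) (Φ : PosFunctor C c₁ c₂ c₃)
         (Ω : Category.Obj C) (dΩ : PosFunctor.∣_∣ Φ Ω) →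
         Construction.LaxNatural C Φ Ω dΩ
         × (Construction.Natural C Φ Ω dΩ → (P : HasSmallProducts C) →
            (X : Category.Obj C) (S : Pred (Category.Hom C X Ω) ℓ) →
            Construction.γ C Φ Ω dΩ X (Construction.α C Φ Ω dΩ X S)
            ≐ Construction.𝒫 C Φ Ω dΩ
                (Construction._• C Φ Ω dΩ (Construction.Powers.⟨S⟩ C Φ Ω dΩ P S))
                (Construction.γ C Φ Ω dΩ (Construction.Powers.Ω^ C Φ Ω dΩ P S)
                   (Construction.Powers.d^ C Φ Ω dΩ P S)))
lemma1 C Φ Ω dΩ = γ-laxNatural C Φ Ω dΩ
                , λ natural P → γ-α≐image-γ-d^ C Φ Ω dΩ P natural
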